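{- For every positive integer $n$, $$\alpha(4,n)=\binom{2\lceil n/2\rceil}{\lceil n/2\rceil}\sum_{i=0}^{\lceil n/2\rceil}\binom{\lceil n/2\rceil}{i}^2\binom{2i}{i}.$$
   Context: For positive integers $m,n$, let $A(m,n)$ be the set of all $m\times n$ matrices with every entry in $\{1,-1\}$ such that every row sum and every column sum has absolute value at most $1$, and let $\alpha(m,n)=|A(m,n)|$. -}

module Defs where

open import Data.Nat using (ℕ; zero; suc; _+_; _*_; _/_)
open import Data.Nat.Combinatorics using (_C_)
open import Data.Integer using (ℤ; +_; -_; ∣_∣) renaming (_+_ to _+ℤ_)
open import Data.Nat using (_≤_)
open import Data.Vec using (Vec; []; _∷_; foldr; map; transpose)
open import Data.Vec.Relation.Unary.All using (All)
open import Data.Product using (Σ)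
open import Data.List using (List; upTo) renaming (map to lmap)
open import Data.Nat.ListAction using () renaming (sum to lsum)

data Sign : Set where
  plus minus : Sign

val : Sign → ℤ
val plus  = + 1
val minus = - (+ 1)

Matrix : ℕ → ℕ → Set
Matrix m n = Vec (Vec Sign n) m

sumℤ : ∀ {k} → Vec ℤ k → ℤ
sumℤ = foldr _ _+ℤ_ (+ 0)

lineSum : ∀ {k} → Vec Sign k → ℤ
lineSum v = sumℤ (map val v)

Balanced : ∀ {k} → Vec Sign k → Set
Balanced v = ∣ lineSum v ∣ ≤ 1

IsA : ∀ {m n} → Matrix m n → Set
IsA {m} {n} M = All Balanced M Data.Product.× All Balanced (transpose M)

A : ℕ → ℕ → Set
A m n = Σ (Matrix m n) IsA

ceilHalf : ℕ → ℕ
ceilHalf n = (n + 1) / 2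

innerSum : ℕ → ℕ
innerSum c = lsum (lmap (λ i → (c C i) * (c C i) * ((2 * i) C i)) (upTo (suc c)))

rhs : ℕ → ℕ
rhs n = ((2 * ceilHalf n) C ceilHalf n) * innerSum (ceilHalf n)

module Submission where

open import Defs
open import Data.Nat using (ℕ; suc)
open import Data.Fin using (Fin)
open import Function.Bundles using (_↔_)

-- A ±1 vector is balanced iff its numbers of +1's and −1's differ by at most one; so a balanced
-- column of height 4 has two +1's and is one of six types, coded as Col (the sign of row 1 and the
-- "partner" row 2, 3 or 4 sharing it).  Hence A(4,n) ↔ words of n columns with balanced rows
-- (matrices↔words).  For odd n = 2k+1 exactly two rows have only k entries +1, and prepending the
-- column with +1 in those rows is a bijection onto the case 2k+2 (Completion).  For even n = 2k
-- every row has exactly k entries +1.  Riffling the columns by the sign of row 1 gives C(2k,k)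
-- shapes and two words of partners of length k, and the remaining rows are balanced iff the two
-- words have the same letter counts (EvenCount).  Such pairs are counted by Σ_i C(k,i)² C(2i,i):
-- record where letters 3, 4 occur (i places in each word) and which of the two, and apply
-- Vandermonde's identity to the latter Boolean words (profilePairs↔innerSum).

open import Data.Nat using (zero; _+_; _*_; _≤_; _<_; z≤n; s≤s; _/_)
open import Data.Nat.Properties
open import Data.Nat.DivMod using (+-distrib-/-∣ʳ; m*n/n≡m)
open import Data.Nat.Divisibility using (n∣m*n)
open import Data.Nat.Combinatorics using (_C_; nCk+nC[k+1]≡[n+1]C[k+1])
open import Data.Nat.ListAction using () renaming (sum to lsum)
open import Data.Nat.Solver using (module +-*-Solver)
open import Data.Integer using (-_; ∣_∣; _⊖_) renaming (_+_ to _+ℤ_; +_ to pos)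
open import Data.Integer.Properties using (distribʳ-⊖-+-pos; distribʳ-⊖-+-neg; [1+m]⊖[1+n]≡m⊖n)
import Data.Fin as Fin
open import Data.Fin.Properties using (+↔⊎; *↔×)
open import Data.Bool using (Bool; true; false; not)
open import Data.Bool.Properties using (not-involutive)
open import Data.Unit using (⊤; tt)
open import Data.Empty using (⊥-elim)
open import Data.Sum using (_⊎_; inj₁; inj₂; [_,_]′)
open import Data.Product using (Σ; _×_; _,_; proj₁; proj₂)
open import Data.Vec using (Vec; []; _∷_; map; replicate; _++_; take; drop; transpose)
open import Data.Vec.Properties
  using (∷-injectiveˡ; ∷-injectiveʳ; take++drop≡id; ++-injectiveˡ; ++-injectiveʳ; map-∘; map-cong; map-id)
open import Data.Vec.Relation.Unary.All as All using (All; []; _∷_)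
open import Data.List using (applyUpTo)
open import Data.List.Properties using (map-applyUpTo)
open import Function using (_∘_)
open import Function.Bundles using (Inverse; mk↔ₛ′)
open import Function.Properties.Inverse using (↔-refl; ↔-sym; ↔-trans)
open import Function.Related.Propositional using (module EquationalReasoning)
open import Data.Product.Function.Dependent.Propositional using (Σ-↔)
open import Data.Product.Function.NonDependent.Propositional using (_×-↔_)
open import Data.Sum.Function.Propositional using (_⊎-↔_)
open import Relation.Nullary using (Irrelevant; does)
open import Relation.Nullary.Decidable using (dec-true; dec-false)
open import Relation.Binary.PropositionalEquality

private
  variable
    a b k n : ℕ
    X Y : Set

cast↔ : (F : ℕ → Set) → a ≡ b → F a ↔ F b
cast↔ F refl = ↔-refl

×-irrelevant : {P Q : Set} → Irrelevant P → Irrelevant Q → Irrelevant (P × Q)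
×-irrelevant irrP irrQ (p , q) (p′ , q′) = cong₂ _,_ (irrP p p′) (irrQ q q′)

Σ-≡-prop : {P : X → Set} → (∀ {x} → Irrelevant (P x)) →
           {x y : X} {p : P x} {q : P y} → x ≡ y → _≡_ {A = Σ X P} (x , p) (y , q)
Σ-≡-prop irr refl = cong (_ ,_) (irr _ _)

prop↔ : {P Q : Set} → Irrelevant P → Irrelevant Q → (P → Q) → (Q → P) → P ↔ Q
prop↔ irrP irrQ f g = mk↔ₛ′ f g (λ q → irrQ _ q) (λ p → irrP _ p)

Σ-prop↔ : {P : X → Set} {Q : Y → Set} (e : X ↔ Y) →
          (∀ {x} → Irrelevant (P x)) → (∀ {y} → Irrelevant (Q y)) →
          (∀ {x} → P x → Q (Inverse.to e x)) → (∀ {x} → Q (Inverse.to e x) → P x) →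
          Σ X P ↔ Σ Y Q
Σ-prop↔ e irrP irrQ f g = Σ-↔ e (prop↔ irrP irrQ f g)

sum↔Σ : (h : ℕ → ℕ) (n : ℕ) → Fin (lsum (applyUpTo h n)) ↔ Σ ℕ (λ i → i < n × Fin (h i))
sum↔Σ h zero = mk↔ₛ′ (λ ()) (λ { (_ , () , _) }) (λ { (_ , () , _) }) (λ ())
sum↔Σ h (suc n) = ↔-trans +↔⊎ (↔-trans (↔-refl ⊎-↔ sum↔Σ (h ∘ suc) n) shift)
  where
  shift : (Fin (h 0) ⊎ Σ ℕ (λ i → i < n × Fin (h (suc i)))) ↔ Σ ℕ (λ i → i < suc n × Fin (h i))
  shift = mk↔ₛ′
    (λ { (inj₁ x) → 0 , s≤s z≤n , x ; (inj₂ (i , i<n , x)) → suc i , s≤s i<n , x })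
    (λ { (zero , _ , x) → inj₁ x ; (suc i , s≤s i<n , x) → inj₂ (i , i<n , x) })
    (λ { (zero , s≤s z≤n , x) → refl ; (suc i , s≤s i<n , x) → refl })
    (λ { (inj₁ x) → refl ; (inj₂ _) → refl })

Σ-fibre↔ : (f g : X → ℕ) (F : ℕ → ℕ → Set) →
  Σ X (λ x → (f x ≡ a × g x ≡ b) × F (f x) (g x)) ↔ (Σ X (λ x → f x ≡ a × g x ≡ b) × F a b)
Σ-fibre↔ f g F = mk↔ₛ′
  (λ { (x , (e , e′) , y) → (x , e , e′) , subst₂ F e e′ y })
  (λ { ((x , e , e′) , y) → x , (e , e′) , subst₂ F (sym e) (sym e′) y })
  (λ { ((x , e , e′) , y) → cong ((x , e , e′) ,_) (there-and-back e e′ y) })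
  (λ { (x , (e , e′) , y) → cong (λ z → x , (e , e′) , z) (back-and-there e e′ y) })
  where
  there-and-back : ∀ {a b a′ b′} (e : a′ ≡ a) (e′ : b′ ≡ b) (y : F a b) →
                   subst₂ F e e′ (subst₂ F (sym e) (sym e′) y) ≡ y
  there-and-back refl refl y = refl
  back-and-there : ∀ {a b a′ b′} (e : a ≡ a′) (e′ : b ≡ b′) (y : F a b) →
                   subst₂ F (sym e) (sym e′) (subst₂ F e e′ y) ≡ y
  back-and-there refl refl y = refl

Σ-diagonal↔ : (f g : X → ℕ) (F : ℕ → ℕ → Set) → (∀ x → f x < n) →
  Σ X (λ x → f x ≡ g x × F (f x) (g x)) ↔
  Σ ℕ (λ i → i < n × (Σ X (λ x → f x ≡ i × g x ≡ i) × F i i))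
Σ-diagonal↔ {X = X} {n = n} f g F bound = mk↔ₛ′ to from to∘from from∘to
  where
  Diagonal Sorted : Set
  Diagonal = Σ X (λ x → f x ≡ g x × F (f x) (g x))
  Sorted   = Σ ℕ (λ i → i < n × (Σ X (λ x → f x ≡ i × g x ≡ i) × F i i))
  to : Diagonal → Sorted
  to (x , e , y) = f x , bound x , (x , refl , sym e) , subst (F (f x)) (sym e) y
  from : Sorted → Diagonal
  from (i , _ , (x , e , e′) , y) = x , trans e (sym e′) , subst₂ F (sym e) (sym e′) y
  diagonal-eq : ∀ {a b} (e : b ≡ a) (y : F a a) →
                subst (F a) (sym (trans refl (sym e))) (subst₂ F refl (sym e) y) ≡ y
  diagonal-eq refl y = refl
  fibre-eq : ∀ {a b} (e : a ≡ b) (y : F a b) →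
    _≡_ {A = a ≡ b × F a b} (trans refl (sym (sym e)) , subst₂ F refl (sym (sym e)) (subst (F a) (sym e) y)) (e , y)
  fibre-eq refl y = refl
  to∘from : ∀ z → to (from z) ≡ z
  to∘from (i , _ , (x , refl , e′) , y) =
    cong (f x ,_) (cong₂ _,_ (<-irrelevant _ _)
      (cong₂ _,_ (cong (λ z → x , refl , z) (≡-irrelevant _ _)) (diagonal-eq e′ y)))
  from∘to : ∀ z → from (to z) ≡ z
  from∘to (x , e , y) = cong (x ,_) (fibre-eq e y)

indicator : Bool → ℕ
indicator true  = 1
indicator false = 0

count : (X → Bool) → Vec X n → ℕ
count p []      = 0
count p (x ∷ v) = indicator (p x) + count p v

trues falses : Vec Bool n → ℕ
trues  = count (λ b → b)
falses = count not

count-cong : {p q : X → Bool} → (∀ x → p x ≡ q x) → (v : Vec X n) → count p v ≡ count q v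
count-cong p≗q []      = refl
count-cong p≗q (x ∷ v) = cong₂ _+_ (cong indicator (p≗q x)) (count-cong p≗q v)

count-map : (p : Y → Bool) (f : X → Y) (v : Vec X n) → count p (map f v) ≡ count (p ∘ f) v
count-map p f []      = refl
count-map p f (x ∷ v) = cong (indicator (p (f x)) +_) (count-map p f v)

count-true : (v : Vec X n) → count (λ _ → true) v ≡ n
count-true []      = refl
count-true (x ∷ v) = cong suc (count-true v)

count-false : (v : Vec X n) → count (λ _ → false) v ≡ 0
count-false []      = refl
count-false (x ∷ v) = count-false v

count-++ : (p : X → Bool) (u : Vec X a) (v : Vec X b) → count p (u ++ v) ≡ count p u + count p v
count-++ p []      v = refl
count-++ p (x ∷ u) v = trans (cong (indicator (p x) +_) (count-++ p u v)) (sym (+-assoc (indicator (p x)) _ _))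

count-complement : (p : X → Bool) (v : Vec X n) → count p v + count (not ∘ p) v ≡ n
count-complement p []      = refl
count-complement p (x ∷ v) with p x
... | true  = cong suc (count-complement p v)
... | false = trans (+-suc (count p v) _) (cong suc (count-complement p v))

trues+falses : (v : Vec Bool n) → trues v + falses v ≡ n
trues+falses = count-complement (λ b → b)

trues≤length : (v : Vec Bool n) → trues v ≤ n
trues≤length v = subst (trues v ≤_) (trues+falses v) (m≤m+n (trues v) (falses v))

trues-complement : (v : Vec Bool n) → trues (map not v) ≡ falses v
trues-complement = count-map (λ b → b) not

complement-involutive : (v : Vec Bool n) → map not (map not v) ≡ v
complement-involutive v = trans (sym (map-∘ not not v)) (trans (map-cong not-involutive v) (map-id v))

-- Boolean words of length n with exactly i trues: the i-element subsets of an n-element set.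
Subsets : ℕ → ℕ → Set
Subsets n i = Σ (Vec Bool n) (λ m → trues m ≡ i)

-- Pascal's rule: an (i+1)-subset of an (n+1)-set either contains the first point or not.
subsets-pascal : (n i : ℕ) → Subsets (suc n) (suc i) ↔ (Subsets n i ⊎ Subsets n (suc i))
subsets-pascal n i = mk↔ₛ′ to from to∘from from∘to
  where
  to : Subsets (suc n) (suc i) → Subsets n i ⊎ Subsets n (suc i)
  to ((true ∷ m) , e)  = inj₁ (m , suc-injective e)
  to ((false ∷ m) , e) = inj₂ (m , e)
  from : Subsets n i ⊎ Subsets n (suc i) → Subsets (suc n) (suc i)
  from (inj₁ (m , e)) = (true ∷ m) , cong suc e
  from (inj₂ (m , e)) = (false ∷ m) , e
  to∘from : ∀ s → to (from s) ≡ s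
  to∘from (inj₁ (m , e)) = cong inj₁ (Σ-≡-prop ≡-irrelevant refl)
  to∘from (inj₂ (m , e)) = refl
  from∘to : ∀ s → from (to s) ≡ s
  from∘to ((true ∷ m) , e)  = Σ-≡-prop ≡-irrelevant refl
  from∘to ((false ∷ m) , e) = refl

subsets-empty : (n : ℕ) → Subsets (suc n) 0 ↔ Subsets n 0
subsets-empty n = mk↔ₛ′ to (λ (m , e) → (false ∷ m) , e) (λ _ → refl) from∘to
  where
  to : Subsets (suc n) 0 → Subsets n 0
  to ((false ∷ m) , e) = m , e
  from∘to : ∀ s → ((false ∷ proj₁ (to s)) , proj₂ (to s)) ≡ s
  from∘to ((false ∷ m) , e) = refl

subsets↔binomial : (n i : ℕ) → Subsets n i ↔ Fin (n C i)
subsets↔binomial zero zero = mk↔ₛ′ (λ _ → Fin.zero) (λ _ → [] , refl) only-zero (λ { ([] , refl) → refl })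
  where
  only-zero : (j : Fin 1) → Fin.zero ≡ j
  only-zero Fin.zero = refl
subsets↔binomial zero (suc i) = mk↔ₛ′ (λ { ([] , ()) }) (λ ()) (λ ()) (λ { ([] , ()) })
subsets↔binomial (suc n) zero = ↔-trans (subsets-empty n) (subsets↔binomial n zero)
subsets↔binomial (suc n) (suc i) = begin
  Subsets (suc n) (suc i)           ↔⟨ subsets-pascal n i ⟩
  (Subsets n i ⊎ Subsets n (suc i)) ↔⟨ subsets↔binomial n i ⊎-↔ subsets↔binomial n (suc i) ⟩
  (Fin (n C i) ⊎ Fin (n C suc i))   ↔⟨ +↔⊎ ⟨
  Fin (n C i + n C suc i)           ≡⟨ cong Fin (nCk+nC[k+1]≡[n+1]C[k+1] n i) ⟩
  Fin (suc n C suc i)               ∎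
  where open EquationalReasoning

EqualTrues : ℕ → ℕ → Set
EqualTrues a b = Σ (Vec Bool a × Vec Bool b) (λ (x , y) → trues x ≡ trues y)

-- Vandermonde's identity Σⱼ C(a,j) C(b,j) = C(a+b,b), bijectively: (x , y) ↦ x ++ complement y.
equalTrues↔subsets : (a b : ℕ) → EqualTrues a b ↔ Subsets (a + b) b
equalTrues↔subsets a b = mk↔ₛ′ to from to∘from from∘to
  where
  to : EqualTrues a b → Subsets (a + b) b
  to ((x , y) , e) = x ++ map not y , (begin
    trues (x ++ map not y)          ≡⟨ count-++ (λ b → b) x (map not y) ⟩
    trues x + trues (map not y)     ≡⟨ cong₂ _+_ e (trues-complement y) ⟩
    trues y + falses y              ≡⟨ trues+falses y ⟩
    b                               ∎)
    where open ≡-Reasoning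
  from : Subsets (a + b) b → EqualTrues a b
  from (z , e) = (x , map not y) , trans x≡falses (sym (trues-complement y))
    where
    x = take a z
    y = drop a z
    x≡falses : trues x ≡ falses y
    x≡falses = +-cancelʳ-≡ (trues y) (trues x) (falses y) (begin
      trues x + trues y     ≡⟨ count-++ (λ b → b) x y ⟨
      trues (x ++ y)        ≡⟨ cong trues (take++drop≡id a z) ⟩
      trues z               ≡⟨ e ⟩
      b                     ≡⟨ trues+falses y ⟨
      trues y + falses y    ≡⟨ +-comm (trues y) (falses y) ⟩
      falses y + trues y    ∎)
      where open ≡-Reasoning
  to∘from : ∀ s → to (from s) ≡ s
  to∘from (z , e) = Σ-≡-prop ≡-irrelevant
    (trans (cong (take a z ++_) (complement-involutive (drop a z))) (take++drop≡id a z))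
  from∘to : ∀ s → from (to s) ≡ s
  from∘to ((x , y) , e) = Σ-≡-prop ≡-irrelevant (cong₂ _,_ take≡x
    (trans (cong (map not) drop≡not-y) (complement-involutive y)))
    where
    z = x ++ map not y
    take≡x : take a z ≡ x
    take≡x = ++-injectiveˡ (take a z) x (take++drop≡id a z)
    drop≡not-y : drop a z ≡ map not y
    drop≡not-y = ++-injectiveʳ (take a z) x (take++drop≡id a z)

-- Riffle decomposition: a word over X ⊎ Y amounts to its shape (the positions of its X-letters)
-- together with the subword of its X-letters and the subword of its Y-letters.
module Riffle (X Y : Set) where

  Riffled : ℕ → Set
  Riffled n = Σ (Vec Bool n) (λ m → Vec X (trues m) × Vec Y (falses m))

  lefts : (r : Riffled n) → Vec X (trues (proj₁ r))
  lefts r = proj₁ (proj₂ r)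

  rights : (r : Riffled n) → Vec Y (falses (proj₁ r))
  rights r = proj₂ (proj₂ r)

  consˡ : X → Riffled n → Riffled (suc n)
  consˡ x (m , u , v) = (true ∷ m) , (x ∷ u) , v

  consʳ : Y → Riffled n → Riffled (suc n)
  consʳ y (m , u , v) = (false ∷ m) , u , (y ∷ v)

  riffle : Vec (X ⊎ Y) n → Riffled n
  riffle []           = [] , [] , []
  riffle (inj₁ x ∷ w) = consˡ x (riffle w)
  riffle (inj₂ y ∷ w) = consʳ y (riffle w)

  unriffle : Riffled n → Vec (X ⊎ Y) n
  unriffle ([] , [] , [])              = []
  unriffle ((true ∷ m) , (x ∷ u) , v)  = inj₁ x ∷ unriffle (m , u , v)
  unriffle ((false ∷ m) , u , (y ∷ v)) = inj₂ y ∷ unriffle (m , u , v)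

  riffle↔ : Vec (X ⊎ Y) n ↔ Riffled n
  riffle↔ = mk↔ₛ′ riffle unriffle riffle∘unriffle unriffle∘riffle
    where
    riffle∘unriffle : (r : Riffled n) → riffle (unriffle r) ≡ r
    riffle∘unriffle ([] , [] , [])              = refl
    riffle∘unriffle ((true ∷ m) , (x ∷ u) , v)  = cong (consˡ x) (riffle∘unriffle (m , u , v))
    riffle∘unriffle ((false ∷ m) , u , (y ∷ v)) = cong (consʳ y) (riffle∘unriffle (m , u , v))
    unriffle∘riffle : (w : Vec (X ⊎ Y) n) → unriffle (riffle w) ≡ w
    unriffle∘riffle []           = refl
    unriffle∘riffle (inj₁ x ∷ w) = cong (inj₁ x ∷_) (unriffle∘riffle w)
    unriffle∘riffle (inj₂ y ∷ w) = cong (inj₂ y ∷_) (unriffle∘riffle w)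

  count-riffle : (p : X → Bool) (q : Y → Bool) (w : Vec (X ⊎ Y) n) →
                 count [ p , q ]′ w ≡ count p (lefts (riffle w)) + count q (rights (riffle w))
  count-riffle p q []           = refl
  count-riffle p q (inj₁ x ∷ w) =
    trans (cong (indicator (p x) +_) (count-riffle p q w)) (sym (+-assoc (indicator (p x)) _ _))
  count-riffle p q (inj₂ y ∷ w) = begin
    indicator (q y) + count [ p , q ]′ w    ≡⟨ cong (indicator (q y) +_) (count-riffle p q w) ⟩
    indicator (q y) + (cₗ + cᵣ)              ≡⟨ x+[y+z]≡y+[x+z] (indicator (q y)) cₗ cᵣ ⟩
    cₗ + (indicator (q y) + cᵣ)              ∎
    where
    open ≡-Reasoning
    cₗ = count p (lefts (riffle w))
    cᵣ = count q (rights (riffle w))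
    x+[y+z]≡y+[x+z] : ∀ x y z → x + (y + z) ≡ y + (x + z)
    x+[y+z]≡y+[x+z] x y z = trans (sym (+-assoc x y z)) (trans (cong (_+ z) (+-comm x y)) (+-assoc y x z))

isPlus : Sign → Bool
isPlus plus  = true
isPlus minus = false

pluses minuses : Vec Sign n → ℕ
pluses  = count isPlus
minuses = count (not ∘ isPlus)

lineSum≡pluses⊖minuses : (v : Vec Sign n) → lineSum v ≡ pluses v ⊖ minuses v
lineSum≡pluses⊖minuses []          = refl
lineSum≡pluses⊖minuses (plus ∷ v)  =
  trans (cong (pos 1 +ℤ_) (lineSum≡pluses⊖minuses v)) (distribʳ-⊖-+-pos 1 (pluses v) (minuses v))
lineSum≡pluses⊖minuses (minus ∷ v) =
  trans (cong (- pos 1 +ℤ_) (lineSum≡pluses⊖minuses v)) (distribʳ-⊖-+-neg 0 (pluses v) (minuses v))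

Near : ℕ → ℕ → Set
Near a b = a ≡ b ⊎ a ≡ suc b ⊎ b ≡ suc a

near-suc : Near a b → Near (suc a) (suc b)
near-suc (inj₁ e)        = inj₁ (cong suc e)
near-suc (inj₂ (inj₁ e)) = inj₂ (inj₁ (cong suc e))
near-suc (inj₂ (inj₂ e)) = inj₂ (inj₂ (cong suc e))

near-pred : Near (suc a) (suc b) → Near a b
near-pred (inj₁ e)        = inj₁ (suc-injective e)
near-pred (inj₂ (inj₁ e)) = inj₂ (inj₁ (suc-injective e))
near-pred (inj₂ (inj₂ e)) = inj₂ (inj₂ (suc-injective e))

⊖-near : (a b : ℕ) → ∣ a ⊖ b ∣ ≤ 1 → Near a b
⊖-near zero          zero          _        = inj₁ refl
⊖-near zero          (suc zero)    _        = inj₂ (inj₂ refl)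
⊖-near zero          (suc (suc b)) (s≤s ())
⊖-near (suc zero)    zero          _        = inj₂ (inj₁ refl)
⊖-near (suc (suc a)) zero          (s≤s ())
⊖-near (suc a)       (suc b)       d≤1      =
  near-suc (⊖-near a b (subst (λ d → ∣ d ∣ ≤ 1) ([1+m]⊖[1+n]≡m⊖n a b) d≤1))

near-⊖ : (a b : ℕ) → Near a b → ∣ a ⊖ b ∣ ≤ 1
near-⊖ zero          zero          _ = z≤n
near-⊖ zero          (suc zero)    _ = s≤s z≤n
near-⊖ zero          (suc (suc b)) (inj₁ ())
near-⊖ zero          (suc (suc b)) (inj₂ (inj₁ ()))
near-⊖ zero          (suc (suc b)) (inj₂ (inj₂ ()))
near-⊖ (suc zero)    zero          _ = s≤s z≤n
near-⊖ (suc (suc a)) zero          (inj₁ ())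
near-⊖ (suc (suc a)) zero          (inj₂ (inj₁ ()))
near-⊖ (suc (suc a)) zero          (inj₂ (inj₂ ()))
near-⊖ (suc a)       (suc b)       near =
  subst (λ d → ∣ d ∣ ≤ 1) (sym ([1+m]⊖[1+n]≡m⊖n a b)) (near-⊖ a b (near-pred near))

balanced⇔near : (v : Vec Sign n) →
  (Balanced v → Near (pluses v) (minuses v)) × (Near (pluses v) (minuses v) → Balanced v)
balanced⇔near v =
  (λ bal → ⊖-near _ _ (subst (λ d → ∣ d ∣ ≤ 1) (lineSum≡pluses⊖minuses v) bal)) ,
  (λ near → subst (λ d → ∣ d ∣ ≤ 1) (sym (lineSum≡pluses⊖minuses v)) (near-⊖ _ _ near))

double-injective : (a b : ℕ) → a + a ≡ b + b → a ≡ b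
double-injective zero    zero    _ = refl
double-injective (suc a) (suc b) e =
  cong suc (double-injective a b (suc-injective (trans (sym (+-suc a a)) (trans (suc-injective e) (+-suc b b)))))

odd≢double : (a b : ℕ) → suc (a + a) ≢ b + b
odd≢double zero    (suc zero)    ()
odd≢double zero    (suc (suc b)) e with suc-injective e
... | ()
odd≢double (suc a) (suc b) e =
  odd≢double a b (suc-injective (trans (sym (cong suc (+-suc a a))) (trans (suc-injective e) (+-suc b b))))

near-even : a + b ≡ k + k → Near a b → a ≡ k
near-even {a = a} {k = k} s (inj₁ refl)        = double-injective a k s
near-even {b = b} {k = k} s (inj₂ (inj₁ refl)) = ⊥-elim (odd≢double b k s)
near-even {a = a} {k = k} s (inj₂ (inj₂ refl)) = ⊥-elim (odd≢double a k (trans (sym (+-suc a a)) s))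

even-near : a ≡ k → a + b ≡ k + k → Near a b
even-near {a = a} {b = b} refl s = inj₁ (sym (+-cancelˡ-≡ a b a s))

near-odd : a + b ≡ suc (k + k) → Near a b → a ≡ k ⊎ a ≡ suc k
near-odd {a = a} {k = k} s (inj₁ refl)        = ⊥-elim (odd≢double k a (sym s))
near-odd {b = b} {k = k} s (inj₂ (inj₁ refl)) = inj₂ (cong suc (double-injective b k (suc-injective s)))
near-odd {a = a} {k = k} s (inj₂ (inj₂ refl)) = inj₁ (double-injective a k (suc-injective (trans (sym (+-suc a a)) s)))

odd-near : a ≡ k ⊎ a ≡ suc k → a + b ≡ suc (k + k) → Near a b
odd-near {a = a} {b = b} (inj₁ refl) s = inj₂ (inj₂ (+-cancelˡ-≡ a b (suc a) (trans s (sym (+-suc a a)))))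
odd-near {k = k} {b = b} (inj₂ refl) s = inj₂ (inj₁ (cong suc (sym (+-cancelˡ-≡ k b k (suc-injective s)))))

balanced-even : (v : Vec Sign n) → n ≡ k + k → Balanced v → pluses v ≡ k
balanced-even v e bal = near-even (trans (count-complement isPlus v) e) (proj₁ (balanced⇔near v) bal)

even-balanced : (v : Vec Sign n) → n ≡ k + k → pluses v ≡ k → Balanced v
even-balanced v e p≡k = proj₂ (balanced⇔near v) (even-near p≡k (trans (count-complement isPlus v) e))

balanced-odd : (v : Vec Sign n) → n ≡ suc (k + k) → Balanced v → pluses v ≡ k ⊎ pluses v ≡ suc k
balanced-odd v e bal = near-odd (trans (count-complement isPlus v) e) (proj₁ (balanced⇔near v) bal)

odd-balanced : (v : Vec Sign n) → n ≡ suc (k + k) → pluses v ≡ k ⊎ pluses v ≡ suc k → Balanced v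
odd-balanced v e p≈k = proj₂ (balanced⇔near v) (odd-near p≈k (trans (count-complement isPlus v) e))

-- A balanced column of height 4 has exactly two entries +1.  It is determined by the sign of its
-- top entry and by its partner: the row among 2, 3, 4 carrying the same sign as row 1.
Partner : Set
Partner = Bool ⊎ ⊤

pattern partner₂ = inj₂ tt
pattern partner₃ = inj₁ true
pattern partner₄ = inj₁ false

-- The six balanced columns: inj₁ p has top entry +1, inj₂ p top entry −1, and partner p.
Col : Set
Col = Partner ⊎ Partner

-- sameᵣ p says whether row r carries the sign of row 1 when the partner is p.
same₁ same₂ same₃ same₄ : Partner → Bool
same₁ = λ _ → true
same₂ = [ (λ _ → false) , (λ _ → true) ]′
same₃ = [ (λ b → b) , (λ _ → false) ]′
same₄ = [ not , (λ _ → false) ]′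

signOf : Bool → Sign
signOf true  = plus
signOf false = minus

isPlus-signOf : (b : Bool) → isPlus (signOf b) ≡ b
isPlus-signOf true  = refl
isPlus-signOf false = refl

signOf-isPlus : (σ : Sign) → signOf (isPlus σ) ≡ σ
signOf-isPlus plus  = refl
signOf-isPlus minus = refl

entry : (Partner → Bool) → Col → Sign
entry same (inj₁ p) = signOf (same p)
entry same (inj₂ p) = signOf (not (same p))

signs : Col → Vec Sign 4
signs c = entry same₁ c ∷ entry same₂ c ∷ entry same₃ c ∷ entry same₄ c ∷ []

row : (Partner → Bool) → Vec Col n → Vec Sign n
row same = map (entry same)

rows : Vec Col n → Matrix 4 n
rows w = row same₁ w ∷ row same₂ w ∷ row same₃ w ∷ row same₄ w ∷ []

RowsBalanced : Vec Col n → Set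
RowsBalanced w = All Balanced (rows w)

allBalanced-irrelevant : {vs : Vec (Vec Sign n) a} → Irrelevant (All Balanced vs)
allBalanced-irrelevant = All.irrelevant (λ {v} → ≤-irrelevant {∣ lineSum v ∣})

-- Decoding a column: its partner is the first of rows 2, 3 with the sign of row 1, else row 4.
partnerOf : Bool → Bool → Partner
partnerOf true  _ = partner₂
partnerOf false b = inj₁ b

fromSigns : Vec Sign 4 → Col
fromSigns (plus ∷ s₂ ∷ s₃ ∷ _ ∷ [])  = inj₁ (partnerOf (isPlus s₂) (isPlus s₃))
fromSigns (minus ∷ s₂ ∷ s₃ ∷ _ ∷ []) = inj₂ (partnerOf (not (isPlus s₂)) (not (isPlus s₃)))

fromSigns-signs : (c : Col) → fromSigns (signs c) ≡ c
fromSigns-signs (inj₁ partner₂) = refl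
fromSigns-signs (inj₁ partner₃) = refl
fromSigns-signs (inj₁ partner₄) = refl
fromSigns-signs (inj₂ partner₂) = refl
fromSigns-signs (inj₂ partner₃) = refl
fromSigns-signs (inj₂ partner₄) = refl

pluses-signs : (c : Col) → pluses (signs c) ≡ 2
pluses-signs (inj₁ partner₂) = refl
pluses-signs (inj₁ partner₃) = refl
pluses-signs (inj₁ partner₄) = refl
pluses-signs (inj₂ partner₂) = refl
pluses-signs (inj₂ partner₃) = refl
pluses-signs (inj₂ partner₄) = refl

signs-fromSigns : (v : Vec Sign 4) → pluses v ≡ 2 → signs (fromSigns v) ≡ v
signs-fromSigns (plus  ∷ plus  ∷ plus  ∷ plus  ∷ []) ()
signs-fromSigns (plus  ∷ plus  ∷ plus  ∷ minus ∷ []) ()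
signs-fromSigns (plus  ∷ plus  ∷ minus ∷ plus  ∷ []) ()
signs-fromSigns (plus  ∷ plus  ∷ minus ∷ minus ∷ []) _ = refl
signs-fromSigns (plus  ∷ minus ∷ plus  ∷ plus  ∷ []) ()
signs-fromSigns (plus  ∷ minus ∷ plus  ∷ minus ∷ []) _ = refl
signs-fromSigns (plus  ∷ minus ∷ minus ∷ plus  ∷ []) _ = refl
signs-fromSigns (plus  ∷ minus ∷ minus ∷ minus ∷ []) ()
signs-fromSigns (minus ∷ plus  ∷ plus  ∷ plus  ∷ []) ()
signs-fromSigns (minus ∷ plus  ∷ plus  ∷ minus ∷ []) _ = refl
signs-fromSigns (minus ∷ plus  ∷ minus ∷ plus  ∷ []) _ = refl
signs-fromSigns (minus ∷ plus  ∷ minus ∷ minus ∷ []) ()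
signs-fromSigns (minus ∷ minus ∷ plus  ∷ plus  ∷ []) _ = refl
signs-fromSigns (minus ∷ minus ∷ plus  ∷ minus ∷ []) ()
signs-fromSigns (minus ∷ minus ∷ minus ∷ plus  ∷ []) ()
signs-fromSigns (minus ∷ minus ∷ minus ∷ minus ∷ []) ()

_∷ᶜ_ : Vec Sign 4 → Matrix 4 n → Matrix 4 (suc n)
(x₁ ∷ x₂ ∷ x₃ ∷ x₄ ∷ []) ∷ᶜ (r₁ ∷ r₂ ∷ r₃ ∷ r₄ ∷ []) = (x₁ ∷ r₁) ∷ (x₂ ∷ r₂) ∷ (x₃ ∷ r₃) ∷ (x₄ ∷ r₄) ∷ []

columnsOf : Matrix 4 n → Vec Col n
columnsOf M = map fromSigns (transpose M)

columnsOf-rows : (w : Vec Col n) → columnsOf (rows w) ≡ w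
columnsOf-rows []      = refl
columnsOf-rows (c ∷ w) = cong₂ _∷_ (fromSigns-signs c) (columnsOf-rows w)

rows-columnsOf : (M : Matrix 4 n) → All Balanced (transpose M) → rows (columnsOf M) ≡ M
rows-columnsOf {zero} ([] ∷ [] ∷ [] ∷ [] ∷ []) [] = refl
rows-columnsOf {suc n} ((x₁ ∷ r₁) ∷ (x₂ ∷ r₂) ∷ (x₃ ∷ r₃) ∷ (x₄ ∷ r₄) ∷ []) (bal ∷ bals) =
  cong₂ _∷ᶜ_ (signs-fromSigns (x₁ ∷ x₂ ∷ x₃ ∷ x₄ ∷ []) (balanced-even (x₁ ∷ x₂ ∷ x₃ ∷ x₄ ∷ []) refl bal))
             (rows-columnsOf (r₁ ∷ r₂ ∷ r₃ ∷ r₄ ∷ []) bals)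

columns-balanced : (w : Vec Col n) → All Balanced (transpose (rows w))
columns-balanced []      = []
columns-balanced (c ∷ w) = even-balanced (signs c) refl (pluses-signs c) ∷ columns-balanced w

BalancedWords : ℕ → Set
BalancedWords n = Σ (Vec Col n) RowsBalanced

matrices↔words : A 4 n ↔ BalancedWords n
matrices↔words = mk↔ₛ′ to from to∘from from∘to
  where
  to : A 4 _ → BalancedWords _
  to (M , rowsBal , colsBal) = columnsOf M , subst (All Balanced) (sym (rows-columnsOf M colsBal)) rowsBal
  from : BalancedWords _ → A 4 _
  from (w , rowsBal) = rows w , rowsBal , columns-balanced w
  to∘from : ∀ x → to (from x) ≡ x
  to∘from (w , _) = Σ-≡-prop allBalanced-irrelevant (columnsOf-rows w)
  from∘to : ∀ x → from (to x) ≡ x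
  from∘to (M , _ , colsBal) = Σ-≡-prop (×-irrelevant allBalanced-irrelevant allBalanced-irrelevant)
    (rows-columnsOf M colsBal)

rowPluses : (Partner → Bool) → Vec Col n → ℕ
rowPluses same w = pluses (row same w)

regroup₄ : ∀ x₁ x₂ x₃ x₄ y₁ y₂ y₃ y₄ →
  (x₁ + y₁) + (x₂ + y₂) + (x₃ + y₃) + (x₄ + y₄) ≡ (x₁ + (x₂ + (x₃ + (x₄ + 0)))) + (y₁ + y₂ + y₃ + y₄)
regroup₄ = solve 8 (λ x₁ x₂ x₃ x₄ y₁ y₂ y₃ y₄ →
  (x₁ :+ y₁) :+ (x₂ :+ y₂) :+ (x₃ :+ y₃) :+ (x₄ :+ y₄) := (x₁ :+ (x₂ :+ (x₃ :+ (x₄ :+ con 0)))) :+ (y₁ :+ y₂ :+ y₃ :+ y₄)) refl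
  where open +-*-Solver

-- Every column has two entries +1, so the four rows of a word of n columns contain 2n of them.
pluses-rows : (w : Vec Col n) →
  rowPluses same₁ w + rowPluses same₂ w + rowPluses same₃ w + rowPluses same₄ w ≡ n + n
pluses-rows []              = refl
pluses-rows {suc n} (c ∷ w) = begin
  (ind same₁ + r same₁) + (ind same₂ + r same₂) + (ind same₃ + r same₃) + (ind same₄ + r same₄)
      ≡⟨ regroup₄ (ind same₁) (ind same₂) (ind same₃) (ind same₄) (r same₁) (r same₂) (r same₃) (r same₄) ⟩
  pluses (signs c) + (r same₁ + r same₂ + r same₃ + r same₄)
      ≡⟨ cong₂ _+_ (pluses-signs c) (pluses-rows w) ⟩
  2 + (n + n)
      ≡⟨ cong suc (sym (+-suc n n)) ⟩
  suc n + suc n ∎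
  where
  open ≡-Reasoning
  ind r : (Partner → Bool) → ℕ
  ind same = indicator (isPlus (entry same c))
  r same = rowPluses same w

-- Odd length reduces to even length.  In a word of 2k+1 columns with balanced rows each row has
-- k or k+1 entries +1, and by pluses-rows exactly two rows, the deficient ones, have only k.
-- Prepending the column with +1 exactly in the deficient rows is a bijection onto the words of
-- 2k+2 columns with balanced rows: conversely, the first column of such a word is forced.
module Completion (k : ℕ) where

  evenLength : suc (suc (k + k)) ≡ suc k + suc k
  evenLength = cong suc (sym (+-suc k k))

  deficient : (Partner → Bool) → Vec Col (suc (k + k)) → Bool
  deficient same w = does (rowPluses same w ≟ k)

  deficiencies : Vec Col (suc (k + k)) → Vec Bool 4
  deficiencies w = deficient same₁ w ∷ deficient same₂ w ∷ deficient same₃ w ∷ deficient same₄ w ∷ []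

  completion : Vec Col (suc (k + k)) → Col
  completion w = fromSigns (map signOf (deficiencies w))

  top-up : {b : ℕ} → b ≡ k ⊎ b ≡ suc k → indicator (does (b ≟ k)) + b ≡ suc k
  top-up {b} (inj₁ b≡k)  rewrite dec-true (b ≟ k) b≡k = cong suc b≡k
  top-up {b} (inj₂ b≡1+k) rewrite dec-false (b ≟ k) (λ b≡k → 1+n≢n (trans (sym b≡1+k) b≡k)) = b≡1+k

  untop : (t : Bool) {b : ℕ} → indicator t + b ≡ suc k → (b ≡ k ⊎ b ≡ suc k) × does (b ≟ k) ≡ t
  untop true  {b} e = inj₁ (suc-injective e) , dec-true (b ≟ k) (suc-injective e)
  untop false {b} e = inj₂ e , dec-false (b ≟ k) (λ b≡k → 1+n≢n (trans (sym e) b≡k))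

  two-deficient : (w : Vec Col (suc (k + k))) → RowsBalanced w → trues (deficiencies w) ≡ 2
  two-deficient w (bal₁ ∷ bal₂ ∷ bal₃ ∷ bal₄ ∷ []) = +-cancelʳ-≡ total (trues (deficiencies w)) 2 (begin
    trues (deficiencies w) + total        ≡⟨ regroup₄ (d same₁) (d same₂) (d same₃) (d same₄) _ _ _ _ ⟨
    (d same₁ + rowPluses same₁ w) + (d same₂ + rowPluses same₂ w) + (d same₃ + rowPluses same₃ w)
      + (d same₄ + rowPluses same₄ w)     ≡⟨ cong₂ _+_ (cong₂ _+_ (cong₂ _+_ (t bal₁) (t bal₂)) (t bal₃)) (t bal₄) ⟩
    suc k + suc k + suc k + suc k         ≡⟨ four-halves k ⟩
    2 + (suc (k + k) + suc (k + k))       ≡⟨ cong (2 +_) (pluses-rows w) ⟨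
    2 + total                             ∎)
    where
    open ≡-Reasoning
    total = rowPluses same₁ w + rowPluses same₂ w + rowPluses same₃ w + rowPluses same₄ w
    d : (Partner → Bool) → ℕ
    d same = indicator (deficient same w)
    t : ∀ {same} → Balanced (row same w) → d same + rowPluses same w ≡ suc k
    t {same} bal = top-up (balanced-odd (row same w) refl bal)
    four-halves : ∀ k → suc k + suc k + suc k + suc k ≡ 2 + (suc (k + k) + suc (k + k))
    four-halves = solve 1 (λ k → (con 1 :+ k) :+ (con 1 :+ k) :+ (con 1 :+ k) :+ (con 1 :+ k)
                                 := con 2 :+ ((con 1 :+ (k :+ k)) :+ (con 1 :+ (k :+ k)))) refl
      where open +-*-Solver

  -- Since two rows are deficient, the completion column has the prescribed signs.
  completion-signs : (w : Vec Col (suc (k + k))) → RowsBalanced w →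
                     signs (completion w) ≡ map signOf (deficiencies w)
  completion-signs w bal = signs-fromSigns (map signOf (deficiencies w))
    (trans (count-map isPlus signOf (deficiencies w))
    (trans (count-cong isPlus-signOf (deficiencies w)) (two-deficient w bal)))

  topped-up : (same : Partner → Bool) (c : Col) (w : Vec Col (suc (k + k))) →
              entry same c ≡ signOf (deficient same w) → Balanced (row same w) → Balanced (row same (c ∷ w))
  topped-up same c w e bal = even-balanced (row same (c ∷ w)) evenLength (begin
    indicator (isPlus (entry same c)) + rowPluses same w            ≡⟨ cong (λ σ → indicator (isPlus σ) + _) e ⟩
    indicator (isPlus (signOf (deficient same w))) + rowPluses same w
      ≡⟨ cong (λ b → indicator b + rowPluses same w) (isPlus-signOf (deficient same w)) ⟩
    indicator (deficient same w) + rowPluses same w                 ≡⟨ top-up (balanced-odd (row same w) refl bal) ⟩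
    suc k                                                           ∎)
    where open ≡-Reasoning

  complete : BalancedWords (suc (k + k)) → BalancedWords (suc (suc (k + k)))
  complete (w , bal@(bal₁ ∷ bal₂ ∷ bal₃ ∷ bal₄ ∷ [])) = (completion w ∷ w) ,
    topped-up same₁ c w e₁ bal₁ ∷ topped-up same₂ c w e₂ bal₂ ∷
    topped-up same₃ c w e₃ bal₃ ∷ topped-up same₄ c w e₄ bal₄ ∷ []
    where
    c = completion w
    e₁ = ∷-injectiveˡ (completion-signs w bal)
    e₂ = ∷-injectiveˡ (∷-injectiveʳ (completion-signs w bal))
    e₃ = ∷-injectiveˡ (∷-injectiveʳ (∷-injectiveʳ (completion-signs w bal)))
    e₄ = ∷-injectiveˡ (∷-injectiveʳ (∷-injectiveʳ (∷-injectiveʳ (completion-signs w bal))))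

  shrunk : (same : Partner → Bool) (c : Col) (w : Vec Col (suc (k + k))) → Balanced (row same (c ∷ w)) →
           Balanced (row same w) × deficient same w ≡ isPlus (entry same c)
  shrunk same c w bal with untop (isPlus (entry same c)) (balanced-even (row same (c ∷ w)) evenLength bal)
  ... | k-or-1+k , deficient≡ = odd-balanced (row same w) refl k-or-1+k , deficient≡

  shrink : BalancedWords (suc (suc (k + k))) → BalancedWords (suc (k + k))
  shrink ((c ∷ w) , bal₁ ∷ bal₂ ∷ bal₃ ∷ bal₄ ∷ []) = w ,
    proj₁ (shrunk same₁ c w bal₁) ∷ proj₁ (shrunk same₂ c w bal₂) ∷
    proj₁ (shrunk same₃ c w bal₃) ∷ proj₁ (shrunk same₄ c w bal₄) ∷ []

  completion-forced : (c : Col) (w : Vec Col (suc (k + k))) → RowsBalanced (c ∷ w) → completion w ≡ c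
  completion-forced c w (bal₁ ∷ bal₂ ∷ bal₃ ∷ bal₄ ∷ []) = begin
    fromSigns (map signOf (deficiencies w))   ≡⟨ cong fromSigns (cong₂ _∷_ (recovered same₁ bal₁)
                                                   (cong₂ _∷_ (recovered same₂ bal₂) (cong₂ _∷_ (recovered same₃ bal₃)
                                                   (cong₂ _∷_ (recovered same₄ bal₄) refl)))) ⟩
    fromSigns (signs c)                       ≡⟨ fromSigns-signs c ⟩
    c                                         ∎
    where
    open ≡-Reasoning
    recovered : (same : Partner → Bool) → Balanced (row same (c ∷ w)) → signOf (deficient same w) ≡ entry same c
    recovered same bal = trans (cong signOf (proj₂ (shrunk same c w bal))) (signOf-isPlus (entry same c))

  odd↔even : BalancedWords (suc (k + k)) ↔ BalancedWords (suc k + suc k)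
  odd↔even = ↔-trans (mk↔ₛ′ complete shrink complete∘shrink shrink∘complete) (cast↔ BalancedWords evenLength)
    where
    shrink∘complete : ∀ x → shrink (complete x) ≡ x
    shrink∘complete (w , _ ∷ _ ∷ _ ∷ _ ∷ []) = Σ-≡-prop allBalanced-irrelevant refl
    complete∘shrink : ∀ x → complete (shrink x) ≡ x
    complete∘shrink ((c ∷ w) , bal@(_ ∷ _ ∷ _ ∷ _ ∷ [])) =
      Σ-≡-prop allBalanced-irrelevant (cong (_∷ w) (completion-forced c w bal))

SameProfile : Vec Partner a → Vec Partner b → Set
SameProfile u v = count same₂ u ≡ count same₂ v × count same₃ u ≡ count same₃ v × count same₄ u ≡ count same₄ v

ProfilePairs : ℕ → ℕ → Set
ProfilePairs a b = Σ (Vec Partner a × Vec Partner b) (λ (u , v) → SameProfile u v)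

MaskedWord : ℕ → Set
MaskedWord n = Σ (Vec Bool n) (λ m → Vec Bool (trues m))

-- A partner word is the set of positions holding partner 3 or 4, with the choice among the two.
partnerWord↔ : Vec Partner n ↔ MaskedWord n
partnerWord↔ = ↔-trans riffle↔ (Σ-↔ ↔-refl drop-units)
  where
  open Riffle Bool ⊤
  units-unique : (t : Vec ⊤ a) → replicate a tt ≡ t
  units-unique []       = refl
  units-unique (tt ∷ t) = cong (tt ∷_) (units-unique t)
  drop-units : (Vec Bool a × Vec ⊤ b) ↔ Vec Bool a
  drop-units = mk↔ₛ′ proj₁ (λ x → x , replicate _ tt) (λ _ → refl) (λ (x , t) → cong (x ,_) (units-unique t))

code : Vec Partner n → MaskedWord n
code = Inverse.to partnerWord↔

positions : (u : Vec Partner n) → Vec Bool n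
positions u = proj₁ (code u)

choices : (u : Vec Partner n) → Vec Bool (trues (positions u))
choices u = proj₂ (code u)

module _ (u : Vec Partner n) where
  open Riffle Bool ⊤ using (riffle; lefts; rights; count-riffle)

  count₂-coded : count same₂ u ≡ falses (positions u)
  count₂-coded = trans (count-riffle (λ _ → false) (λ _ → true) u)
    (cong₂ _+_ (count-false (lefts (riffle u))) (count-true (rights (riffle u))))

  count₃-coded : count same₃ u ≡ trues (choices u)
  count₃-coded = trans (count-riffle (λ b → b) (λ _ → false) u)
    (trans (cong (trues (choices u) +_) (count-false (rights (riffle u)))) (+-identityʳ _))

  count₄-coded : count same₄ u ≡ falses (choices u)
  count₄-coded = trans (count-riffle not (λ _ → false) u)
    (trans (cong (falses (choices u) +_) (count-false (rights (riffle u)))) (+-identityʳ _))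

trues≡⇒falses≡ : (x : Vec Bool a) (y : Vec Bool b) → a ≡ b → trues x ≡ trues y → falses x ≡ falses y
trues≡⇒falses≡ x y a≡b t = +-cancelˡ-≡ (trues x) (falses x) (falses y)
  (trans (trues+falses x) (trans a≡b (trans (sym (trues+falses y)) (cong (_+ falses y) (sym t)))))

falses≡⇒trues≡ : (x : Vec Bool a) (y : Vec Bool b) → a ≡ b → falses x ≡ falses y → trues x ≡ trues y
falses≡⇒trues≡ x y a≡b f = +-cancelʳ-≡ (falses x) (trues x) (trues y)
  (trans (trues+falses x) (trans a≡b (trans (sym (trues+falses y)) (cong (trues y +_) (sym f)))))

SameCounts : MaskedWord a × MaskedWord b → Set
SameCounts ((m , x) , (m′ , x′)) = trues m ≡ trues m′ × trues x ≡ trues x′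

sameProfile⇒sameCounts : (u v : Vec Partner k) → SameProfile u v →
                         SameCounts (code u , code v)
sameProfile⇒sameCounts u v (c₂ , c₃ , c₄) =
  falses≡⇒trues≡ (positions u) (positions v) refl (trans (sym (count₂-coded u)) (trans c₂ (count₂-coded v))) ,
  trans (sym (count₃-coded u)) (trans c₃ (count₃-coded v))

sameCounts⇒sameProfile : (u v : Vec Partner k) →
                         SameCounts (code u , code v) → SameProfile u v
sameCounts⇒sameProfile u v (t , t′) =
  trans (count₂-coded u) (trans (trues≡⇒falses≡ (positions u) (positions v) refl t) (sym (count₂-coded v))) ,
  trans (count₃-coded u) (trans t′ (sym (count₃-coded v))) ,
  trans (count₄-coded u) (trans (trues≡⇒falses≡ (choices u) (choices v) t t′) (sym (count₄-coded v)))

≡×≡-irrelevant : {x y z w : ℕ} → Irrelevant (x ≡ y × z ≡ w)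
≡×≡-irrelevant = ×-irrelevant ≡-irrelevant ≡-irrelevant

-- The pairs of words of length k over three letters with equal letter counts are counted by
-- Σᵢ C(k,i)² C(2i,i): code each word by the i positions of letters 3, 4 and a Boolean word of
-- length i choosing between them; group by i and apply Vandermonde to the Boolean words.
profilePairs↔innerSum : (k : ℕ) → ProfilePairs k k ↔ Fin (innerSum k)
profilePairs↔innerSum k = begin
  ProfilePairs k k
    ↔⟨ Σ-prop↔ (partnerWord↔ ×-↔ partnerWord↔) (×-irrelevant ≡-irrelevant ≡×≡-irrelevant) ≡×≡-irrelevant
               (λ {(u , v)} → sameProfile⇒sameCounts u v) (λ {(u , v)} → sameCounts⇒sameProfile u v) ⟩
  Σ (MaskedWord k × MaskedWord k) SameCounts
    ↔⟨ regroup ⟩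
  Σ (Vec Bool k × Vec Bool k) (λ (m , m′) → trues m ≡ trues m′ × EqualTrues (trues m) (trues m′))
    ↔⟨ Σ-diagonal↔ (trues ∘ proj₁) (trues ∘ proj₂) EqualTrues (λ (m , _) → s≤s (trues≤length m)) ⟩
  Σ ℕ (λ i → i < suc k × (SizePairs i × EqualTrues i i))
    ↔⟨ Σ-↔ ↔-refl (↔-refl ×-↔ term↔) ⟩
  Σ ℕ (λ i → i < suc k × Fin (term i))
    ↔⟨ sum↔Σ term (suc k) ⟨
  Fin (lsum (applyUpTo term (suc k)))
    ≡⟨ cong (Fin ∘ lsum) (sym (map-applyUpTo (λ i → i) term (suc k))) ⟩
  Fin (innerSum k) ∎
  where
  open EquationalReasoning
  term : ℕ → ℕ
  term i = (k C i) * (k C i) * ((2 * i) C i)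

  SizePairs : ℕ → Set
  SizePairs i = Σ (Vec Bool k × Vec Bool k) (λ (m , m′) → trues m ≡ i × trues m′ ≡ i)

  regroup : Σ (MaskedWord k × MaskedWord k) SameCounts ↔
            Σ (Vec Bool k × Vec Bool k) (λ (m , m′) → trues m ≡ trues m′ × EqualTrues (trues m) (trues m′))
  regroup = mk↔ₛ′ (λ (((m , x) , (m′ , x′)) , t , t′) → (m , m′) , t , ((x , x′) , t′))
                  (λ ((m , m′) , t , ((x , x′) , t′)) → ((m , x) , (m′ , x′)) , t , t′)
                  (λ _ → refl) (λ _ → refl)

  sizePairs↔ : (i : ℕ) → SizePairs i ↔ (Subsets k i × Subsets k i)
  sizePairs↔ i = mk↔ₛ′ (λ ((m , m′) , e , e′) → (m , e) , (m′ , e′)) (λ ((m , e) , (m′ , e′)) → (m , m′) , e , e′)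
                       (λ _ → refl) (λ _ → refl)

  term↔ : {i : ℕ} → (SizePairs i × EqualTrues i i) ↔ Fin (term i)
  term↔ {i} = begin
    (SizePairs i × EqualTrues i i)
      ↔⟨ sizePairs↔ i ×-↔ equalTrues↔subsets i i ⟩
    ((Subsets k i × Subsets k i) × Subsets (i + i) i)
      ↔⟨ (subsets↔binomial k i ×-↔ subsets↔binomial k i) ×-↔ subsets↔binomial (i + i) i ⟩
    ((Fin (k C i) × Fin (k C i)) × Fin ((i + i) C i))
      ↔⟨ ↔-sym *↔× ×-↔ ↔-refl ⟩
    (Fin ((k C i) * (k C i)) × Fin ((i + i) C i))
      ↔⟨ *↔× ⟨
    Fin ((k C i) * (k C i) * ((i + i) C i))
      ≡⟨ cong (λ j → Fin ((k C i) * (k C i) * (j C i))) (cong (i +_) (sym (+-identityʳ i))) ⟩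
    Fin (term i) ∎

-- Row counts of a word of columns, read off its riffle by the sign of row 1: row r has a +1 in a
-- column with top entry +1 iff r is the partner, and in a column with top entry −1 iff it is not.
module ColumnRiffle = Riffle Partner Partner
open ColumnRiffle using (Riffled; riffle; riffle↔; lefts; rights; count-riffle)

row-riffle : (same : Partner → Bool) (w : Vec Col n) →
             rowPluses same w ≡ count same (lefts (riffle w)) + count (not ∘ same) (rights (riffle w))
row-riffle same w = trans (count-map isPlus (entry same) w)
                   (trans (count-cong isPlus-entry w) (count-riffle same (not ∘ same) w))
  where
  isPlus-entry : (c : Col) → isPlus (entry same c) ≡ [ same , not ∘ same ]′ c
  isPlus-entry (inj₁ p) = isPlus-signOf (same p)
  isPlus-entry (inj₂ p) = isPlus-signOf (not (same p))

row₁-riffle : (w : Vec Col n) → rowPluses same₁ w ≡ trues (proj₁ (riffle w))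
row₁-riffle w = trans (row-riffle same₁ w)
  (trans (cong₂ _+_ (count-true (lefts (riffle w))) (count-false (rights (riffle w)))) (+-identityʳ _))

-- Even length.  In a word of 2k columns with balanced rows every row has exactly k entries +1.
-- Riffling by the sign of row 1 thus gives a shape with k trues (C(2k,k) choices) and two partner
-- words of length k, and the rows 2, 3, 4 have k entries +1 iff these words have the same profile.
module EvenCount (k : ℕ) where

  RowsHalf : Vec Col (k + k) → Set
  RowsHalf w = rowPluses same₁ w ≡ k × rowPluses same₂ w ≡ k × rowPluses same₃ w ≡ k × rowPluses same₄ w ≡ k

  GoodRiffle : Riffled (k + k) → Set
  GoodRiffle (m , u , v) = (trues m ≡ k × falses m ≡ k) × SameProfile u v

  ≡×≡×≡-irrelevant : {x y z w s t : ℕ} → Irrelevant (x ≡ y × z ≡ w × s ≡ t)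
  ≡×≡×≡-irrelevant = ×-irrelevant ≡-irrelevant ≡×≡-irrelevant

  rowsHalf-irrelevant : (w : Vec Col (k + k)) → Irrelevant (RowsHalf w)
  rowsHalf-irrelevant w = ×-irrelevant ≡-irrelevant ≡×≡×≡-irrelevant

  balanced⇒half : (w : Vec Col (k + k)) → RowsBalanced w → RowsHalf w
  balanced⇒half w (bal₁ ∷ bal₂ ∷ bal₃ ∷ bal₄ ∷ []) =
    balanced-even (row same₁ w) refl bal₁ , balanced-even (row same₂ w) refl bal₂ ,
    balanced-even (row same₃ w) refl bal₃ , balanced-even (row same₄ w) refl bal₄

  half⇒balanced : (w : Vec Col (k + k)) → RowsHalf w → RowsBalanced w
  half⇒balanced w (h₁ , h₂ , h₃ , h₄) =
    even-balanced (row same₁ w) refl h₁ ∷ even-balanced (row same₂ w) refl h₂ ∷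
    even-balanced (row same₃ w) refl h₃ ∷ even-balanced (row same₄ w) refl h₄ ∷ []

  falses-half : (m : Vec Bool (k + k)) → trues m ≡ k → falses m ≡ k
  falses-half m t = +-cancelˡ-≡ k (falses m) k (trans (cong (_+ falses m) (sym t)) (trues+falses m))

  module _ (same : Partner → Bool) (w : Vec Col (k + k)) (f : falses (proj₁ (riffle w)) ≡ k) where
    private
      u = lefts (riffle w)
      v = rights (riffle w)
      complement-v : count same v + count (not ∘ same) v ≡ k
      complement-v = trans (count-complement same v) f

    row-half⇒equal : rowPluses same w ≡ k → count same u ≡ count same v
    row-half⇒equal h = +-cancelʳ-≡ (count (not ∘ same) v) (count same u) (count same v)
      (trans (sym (row-riffle same w)) (trans h (sym complement-v)))

    equal⇒row-half : count same u ≡ count same v → rowPluses same w ≡ k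
    equal⇒row-half e = trans (row-riffle same w) (trans (cong (_+ count (not ∘ same) v) e) complement-v)

  half⇒good : (w : Vec Col (k + k)) → RowsHalf w → GoodRiffle (riffle w)
  half⇒good w (h₁ , h₂ , h₃ , h₄) = (t , f) ,
    row-half⇒equal same₂ w f h₂ , row-half⇒equal same₃ w f h₃ , row-half⇒equal same₄ w f h₄
    where
    t = trans (sym (row₁-riffle w)) h₁
    f = falses-half (proj₁ (riffle w)) t

  good⇒half : (w : Vec Col (k + k)) → GoodRiffle (riffle w) → RowsHalf w
  good⇒half w ((t , f) , e₂ , e₃ , e₄) = trans (row₁-riffle w) t ,
    equal⇒row-half same₂ w f e₂ , equal⇒row-half same₃ w f e₃ , equal⇒row-half same₄ w f e₄

  regroup : Σ (Riffled (k + k)) GoodRiffle ↔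
            Σ (Vec Bool (k + k)) (λ m → (trues m ≡ k × falses m ≡ k) × ProfilePairs (trues m) (falses m))
  regroup = mk↔ₛ′ (λ ((m , u , v) , h , e) → m , h , ((u , v) , e)) (λ (m , h , ((u , v) , e)) → (m , u , v) , h , e)
                  (λ _ → refl) (λ _ → refl)

  shapes↔binomial : Σ (Vec Bool (k + k)) (λ m → trues m ≡ k × falses m ≡ k) ↔ Fin ((k + k) C k)
  shapes↔binomial = ↔-trans (Σ-prop↔ ↔-refl ≡×≡-irrelevant ≡-irrelevant proj₁ (λ {m} t → t , falses-half m t))
                            (subsets↔binomial (k + k) k)

  evenWords↔ : BalancedWords (k + k) ↔ Fin (((k + k) C k) * innerSum k)
  evenWords↔ = begin
    BalancedWords (k + k)
      ↔⟨ Σ-prop↔ ↔-refl allBalanced-irrelevant (λ {w} → rowsHalf-irrelevant w)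
                 (λ {w} → balanced⇒half w) (λ {w} → half⇒balanced w) ⟩
    Σ (Vec Col (k + k)) RowsHalf
      ↔⟨ Σ-prop↔ riffle↔ (λ {w} → rowsHalf-irrelevant w) (×-irrelevant ≡×≡-irrelevant ≡×≡×≡-irrelevant)
                 (λ {w} → half⇒good w) (λ {w} → good⇒half w) ⟩
    Σ (Riffled (k + k)) GoodRiffle
      ↔⟨ regroup ⟩
    Σ (Vec Bool (k + k)) (λ m → (trues m ≡ k × falses m ≡ k) × ProfilePairs (trues m) (falses m))
      ↔⟨ Σ-fibre↔ trues falses ProfilePairs ⟩
    (Σ (Vec Bool (k + k)) (λ m → trues m ≡ k × falses m ≡ k) × ProfilePairs k k)
      ↔⟨ shapes↔binomial ×-↔ profilePairs↔innerSum k ⟩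
    (Fin ((k + k) C k) × Fin (innerSum k))
      ↔⟨ *↔× ⟨
    Fin (((k + k) C k) * innerSum k) ∎
    where open EquationalReasoning

ceilHalf-even : (k : ℕ) → ceilHalf (k + k) ≡ k
ceilHalf-even k = begin
  (k + k + 1) / 2     ≡⟨ cong (_/ 2) (solve 1 (λ k → k :+ k :+ con 1 := con 1 :+ k :* con 2) refl k) ⟩
  (1 + k * 2) / 2     ≡⟨ +-distrib-/-∣ʳ 1 (n∣m*n k {2}) ⟩
  0 + k * 2 / 2       ≡⟨ m*n/n≡m k 2 ⟩
  k                   ∎
  where open ≡-Reasoning; open +-*-Solver

ceilHalf-odd : (k : ℕ) → ceilHalf (suc (k + k)) ≡ suc k
ceilHalf-odd k = begin
  (suc (k + k) + 1) / 2 ≡⟨ cong (_/ 2) (solve 1 (λ k → con 1 :+ (k :+ k) :+ con 1 := con 2 :+ k :* con 2) refl k) ⟩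
  (2 + k * 2) / 2       ≡⟨ +-distrib-/-∣ʳ 2 (n∣m*n k {2}) ⟩
  1 + k * 2 / 2         ≡⟨ cong suc (m*n/n≡m k 2) ⟩
  suc k                 ∎
  where open ≡-Reasoning; open +-*-Solver

rhs-at : (n c : ℕ) → ceilHalf n ≡ c → rhs n ≡ ((c + c) C c) * innerSum c
rhs-at n c refl = cong (λ m → (m C c) * innerSum c) (cong (c +_) (+-identityʳ c))

parity-split : (n : ℕ) → Σ ℕ (λ k → n ≡ k + k) ⊎ Σ ℕ (λ k → n ≡ suc (k + k))
parity-split zero = inj₁ (0 , refl)
parity-split (suc n) with parity-split n
... | inj₁ (k , e) = inj₂ (k , cong suc e)
... | inj₂ (k , e) = inj₁ (suc k , trans (cong suc e) (cong suc (sym (+-suc k k))))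

α-even : (k : ℕ) → A 4 (k + k) ↔ Fin (rhs (k + k))
α-even k = begin
  A 4 (k + k)                         ↔⟨ matrices↔words ⟩
  BalancedWords (k + k)               ↔⟨ EvenCount.evenWords↔ k ⟩
  Fin (((k + k) C k) * innerSum k)    ≡⟨ cong Fin (rhs-at (k + k) k (ceilHalf-even k)) ⟨
  Fin (rhs (k + k))                   ∎
  where open EquationalReasoning

α-odd : (k : ℕ) → A 4 (suc (k + k)) ↔ Fin (rhs (suc (k + k)))
α-odd k = begin
  A 4 (suc (k + k))                                    ↔⟨ matrices↔words ⟩
  BalancedWords (suc (k + k))                          ↔⟨ Completion.odd↔even k ⟩
  BalancedWords (suc k + suc k)                        ↔⟨ EvenCount.evenWords↔ (suc k) ⟩
  Fin (((suc k + suc k) C suc k) * innerSum (suc k))   ≡⟨ cong Fin (rhs-at (suc (k + k)) (suc k) (ceilHalf-odd k)) ⟨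
  Fin (rhs (suc (k + k)))                              ∎
  where open EquationalReasoning

α : (n : ℕ) → A 4 n ↔ Fin (rhs n)
α n with parity-split n
... | inj₁ (k , refl) = α-even k
... | inj₂ (k , refl) = α-odd k

theorem2 : (n : ℕ) → A 4 (suc n) ↔ Fin (rhs (suc n))
theorem2 n = α (suc n)
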